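{- Let $G$ be a graph obtained from $K_4$ by subdividing one edge of $K_4$ at least once and each of the other five edges of $K_4$ exactly once. Then $\operatorname{tww}(G)=2$.
   Context: Subdividing an edge replaces it by a path through a new degree-2 vertex; subdividing $k$ times replaces it by a path of length $k+1$. Twin-width: for a trigraph (vertex set with disjoint black and red edge sets; a graph has no red edges), contracting distinct $u,v$ gives a new vertex $x$ with $xy$ black if $uy,vy$ both black, absent if neither is an edge, red otherwise; twin-width is the least $d$ such that some sequence of contractions down to one vertex keeps every trigraph's maximum red degree at most $d$. -}

module Defs where

open import Data.Nat using (ℕ; zero; suc; _+_; _≤_; _<_; _≡ᵇ_; _≤ᵇ_)
open import Data.Fin using (Fin; toℕ; punchIn; punchOut; _≟_)
open import Data.Bool using (Bool; true; false; _∨_; _∧_; if_then_else_)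
open import Data.List using (List; length; filter; allFin)
open import Data.Product using (_×_; _,_)
open import Relation.Nullary using (¬_; Dec; yes; no)
open import Relation.Binary.PropositionalEquality using (_≡_; _≢_; refl)

data Col : Set where
  none black red : Col

Trigraph : ℕ → Set
Trigraph n = Fin n → Fin n → Col

-- colour of xy after contracting u,v (given uy and vy)
merge : Col → Col → Col
merge black black = black
merge none  none  = none
merge _     _     = red

isRed : Col → Bool
isRed red = true
isRed _   = false

-- The new vertex set is
-- Fin n: vertex v is removed (new vertex a corresponds to old punchIn v a),
-- and the old vertex u is replaced by the contracted vertex x (at position
-- punchOut u≢v).
contract : ∀ {n} → Trigraph (suc n) → (u v : Fin (suc n)) → u ≢ v → Trigraph n
contract {n} t u v u≢v a b with a ≟ b
... | yes _ = none
... | no _ with punchIn v a ≟ u | punchIn v b ≟ u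
...   | yes _ | _     = merge (t u (punchIn v b)) (t v (punchIn v b))
...   | no _  | yes _ = merge (t u (punchIn v a)) (t v (punchIn v a))
...   | no _  | no _  = t (punchIn v a) (punchIn v b)

redDeg : ∀ {n} → Trigraph n → Fin n → ℕ
redDeg {n} t a = length (filter (λ b → isRed (t a b) Data.Bool.≟ true) (allFin n))

MaxRedDeg≤ : ∀ {n} → Trigraph n → ℕ → Set
MaxRedDeg≤ {n} t d = (a : Fin n) → redDeg t a ≤ d

data ContrSeq (d : ℕ) : ∀ {n} → Trigraph n → Set where
  done : (t : Trigraph 1) → ContrSeq d t
  step : ∀ {n} (t : Trigraph (suc (suc n))) (u v : Fin (suc (suc n)))
         (u≢v : u ≢ v) →
         MaxRedDeg≤ (contract t u v u≢v) d →
         ContrSeq d (contract t u v u≢v) →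
         ContrSeq d t

TwwAtMost : ∀ {n} → ℕ → Trigraph n → Set
TwwAtMost d t = MaxRedDeg≤ t d × ContrSeq d t

TwinWidth≡ : ∀ {n} → Trigraph n → ℕ → Set
TwinWidth≡ t d = TwwAtMost d t × ((d' : ℕ) → d' < d → ¬ TwwAtMost d' t)

-- The graph G_k (k ≥ 1): K4 on branch vertices 0,1,2,3; edge 01 subdivided
-- k times (path 0 - 9 - 10 - ... - (8+k) - 1), edges 02,03,12,13,23
-- subdivided once by vertices 4,5,6,7,8 respectively.

baseEdge : ℕ → ℕ → Bool
baseEdge a b =
     ((a ≡ᵇ 0) ∧ (b ≡ᵇ 4)) ∨ ((a ≡ᵇ 4) ∧ (b ≡ᵇ 2))
  ∨ ((a ≡ᵇ 0) ∧ (b ≡ᵇ 5)) ∨ ((a ≡ᵇ 5) ∧ (b ≡ᵇ 3))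
  ∨ ((a ≡ᵇ 1) ∧ (b ≡ᵇ 6)) ∨ ((a ≡ᵇ 6) ∧ (b ≡ᵇ 2))
  ∨ ((a ≡ᵇ 1) ∧ (b ≡ᵇ 7)) ∨ ((a ≡ᵇ 7) ∧ (b ≡ᵇ 3))
  ∨ ((a ≡ᵇ 2) ∧ (b ≡ᵇ 8)) ∨ ((a ≡ᵇ 8) ∧ (b ≡ᵇ 3))

pathEdge : ℕ → ℕ → ℕ → Bool
pathEdge k a b =
     ((a ≡ᵇ 0) ∧ (b ≡ᵇ 9))
  ∨ ((9 ≤ᵇ a) ∧ ((b ≡ᵇ suc a) ∧ (suc a ≤ᵇ 8 + k)))
  ∨ ((a ≡ᵇ 8 + k) ∧ (b ≡ᵇ 1))

dirEdge : ℕ → ℕ → ℕ → Bool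
dirEdge k a b = baseEdge a b ∨ pathEdge k a b

G : (k : ℕ) → Trigraph (9 + k)
G k a b = if dirEdge k (toℕ a) (toℕ b) ∨ dirEdge k (toℕ b) (toℕ a) then black else none

-- For k ≥ 1 the graph G k is separated: for any two distinct vertices u and v
-- some vertex is adjacent to u but not to v, and some vertex to v but not to u.
-- So the first contraction of any sequence creates a vertex with two red edges,
-- and the twin-width is at least 2.  Conversely, contracting the last two vertices
-- of the long path of G (k + 1) yields G k with both edges at the end of its long
-- path turned red.  Contracting the last two path vertices of that trigraph again
-- gives the same kind of trigraph with a shorter path, all red degrees staying at
-- most 2, until ten vertices are left; that trigraph and G 1 are finished by
-- explicit 2-sequences checked by evaluation.

module Submission where

open import Defs
open import Data.Nat using (ℕ; zero; suc; _+_; _∸_; _≤_; _<_; _≡ᵇ_; _≤ᵇ_; z≤n; s≤s; s≤s⁻¹)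
open import Data.Nat.Properties
open import Data.Fin using (Fin; zero; suc; toℕ; fromℕ; fromℕ<; inject₁; punchIn; punchOut; #_)
import Data.Fin as Fin
open import Data.Fin.Properties
  using (all?; any?; toℕ-injective; toℕ<n; toℕ-fromℕ<; toℕ-fromℕ; toℕ-inject₁; fromℕ≢inject₁;
         punchIn-punchOut)
open import Data.Bool using (Bool; true; false; _∨_; _∧_; T; if_then_else_)
import Data.Bool.Properties as Bool
open import Data.Bool.Properties using (∨-comm; ∨-identityʳ; ∨-zeroʳ; ∧-zeroʳ)
open import Data.List using (List; []; _∷_; length; filter; allFin)
open import Data.List.Properties using (filter-≐)
open import Data.List.Membership.Propositional using (_∈_)
open import Data.List.Membership.Propositional.Properties using (∈-filter⁺; ∈-filter⁻; ∈-allFin)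
open import Data.List.Relation.Unary.Any using (here; there)
open import Data.List.Relation.Unary.AllPairs using (_∷_)
open import Data.List.Relation.Unary.All using (_∷_)
open import Data.List.Relation.Unary.Unique.Propositional using (Unique)
open import Data.List.Relation.Unary.Unique.Propositional.Properties using (filter⁺; allFin⁺)
open import Data.Maybe using (Maybe; just; nothing; from-just)
open import Data.Product using (_×_; _,_; ∃-syntax; Σ-syntax; proj₂)
open import Data.Sum using (_⊎_; inj₁; inj₂)
open import Data.Empty using (⊥; ⊥-elim)
open import Function using (_∘_; case_of_)
open import Relation.Nullary using (¬_; ¬?; Dec; yes; no)
open import Relation.Nullary.Decidable using (from-yes; dec-true; dec-false; _×-dec_; _⊎-dec_; _→-dec_)
open import Relation.Binary using (tri<; tri≈; tri>)
open import Relation.Binary.PropositionalEquality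

_≗₂_ : ∀ {n} → Trigraph n → Trigraph n → Set
t ≗₂ t′ = ∀ a b → t a b ≡ t′ a b

≗₂-sym : ∀ {n} {t t′ : Trigraph n} → t ≗₂ t′ → t′ ≗₂ t
≗₂-sym eq a b = sym (eq a b)

contract-cong : ∀ {n} {t t′ : Trigraph (suc n)} → t ≗₂ t′ →
                ∀ u v (u≢v : u ≢ v) → contract t u v u≢v ≗₂ contract t′ u v u≢v
contract-cong eq u v _ a b with a Fin.≟ b
... | yes _ = refl
... | no _ with punchIn v a Fin.≟ u | punchIn v b Fin.≟ u
...   | yes _ | _     = cong₂ merge (eq u (punchIn v b)) (eq v (punchIn v b))
...   | no _  | yes _ = cong₂ merge (eq u (punchIn v a)) (eq v (punchIn v a))
...   | no _  | no _  = eq (punchIn v a) (punchIn v b)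

redDeg-cong : ∀ {n} {t t′ : Trigraph n} → t ≗₂ t′ → ∀ a → redDeg t a ≡ redDeg t′ a
redDeg-cong {n} {t} {t′} eq a = cong length (filter-≐ _ _ (to , from) (allFin n))
  where
  to : ∀ {b} → isRed (t a b) ≡ true → isRed (t′ a b) ≡ true
  to {b} = subst (λ c → isRed c ≡ true) (eq a b)
  from : ∀ {b} → isRed (t′ a b) ≡ true → isRed (t a b) ≡ true
  from {b} = subst (λ c → isRed c ≡ true) (sym (eq a b))

maxRedDeg≤-cong : ∀ {n d} {t t′ : Trigraph n} → t ≗₂ t′ → MaxRedDeg≤ t d → MaxRedDeg≤ t′ d
maxRedDeg≤-cong {d = d} eq bound a = subst (_≤ d) (redDeg-cong eq a) (bound a)

contrSeq-cong : ∀ {n d} {t t′ : Trigraph n} → t ≗₂ t′ → ContrSeq d t → ContrSeq d t′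
contrSeq-cong {t′ = t′} eq (done _) = done t′
contrSeq-cong {t′ = t′} eq (step _ u v u≢v bound seq) =
  step t′ u v u≢v (maxRedDeg≤-cong eq′ bound) (contrSeq-cong eq′ seq)
  where eq′ = contract-cong eq u v u≢v

isRed-red : ∀ {c} → c ≡ red → isRed c ≡ true
isRed-red refl = refl

red-isRed : ∀ {c} → isRed c ≡ true → c ≡ red
red-isRed {red} _ = refl

redDeg≥2 : ∀ {n} (t : Trigraph n) a {b₁ b₂} → b₁ ≢ b₂ → t a b₁ ≡ red → t a b₂ ≡ red → 2 ≤ redDeg t a
redDeg≥2 {n} t a b₁≢b₂ r₁ r₂ =
  two-members b₁≢b₂ (∈-filter⁺ red? (∈-allFin _) (isRed-red r₁))
                    (∈-filter⁺ red? (∈-allFin _) (isRed-red r₂))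
  where
  red? = λ b → isRed (t a b) Bool.≟ true
  two-members : ∀ {xs : List (Fin n)} {y z} → y ≢ z → y ∈ xs → z ∈ xs → 2 ≤ length xs
  two-members {_ ∷ []} y≢z (here refl) (here refl) = ⊥-elim (y≢z refl)
  two-members {_ ∷ _ ∷ _} _ _ _ = s≤s (s≤s z≤n)

redDeg≤2 : ∀ {n} (t : Trigraph n) a x y →
           (∀ b → t a b ≡ red → toℕ b ≡ x ⊎ toℕ b ≡ y) → redDeg t a ≤ 2
redDeg≤2 {n} t a x y onlyXY =
  go (filter red? (allFin n)) (filter⁺ red? (allFin⁺ n))
     (λ b b∈ → onlyXY b (red-isRed (proj₂ (∈-filter⁻ red? {xs = allFin n} b∈))))
  where
  red? = λ b → isRed (t a b) Bool.≟ true
  XorY = λ (b : Fin n) → toℕ b ≡ x ⊎ toℕ b ≡ y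
  go : (bs : List (Fin n)) → Unique bs → (∀ b → b ∈ bs → XorY b) → length bs ≤ 2
  go [] _ _ = z≤n
  go (_ ∷ []) _ _ = s≤s z≤n
  go (_ ∷ _ ∷ []) _ _ = s≤s (s≤s z≤n)
  go (b₁ ∷ b₂ ∷ b₃ ∷ _) ((b₁≢b₂ ∷ b₁≢b₃ ∷ _) ∷ (b₂≢b₃ ∷ _) ∷ _) xy =
    ⊥-elim (pigeonhole (xy b₁ (here refl)) (xy b₂ (there (here refl)))
                       (xy b₃ (there (there (here refl)))))
    where
    same : ∀ {b b′ z} → b ≢ b′ → toℕ b ≡ z → toℕ b′ ≡ z → ⊥
    same b≢b′ p q = b≢b′ (toℕ-injective (trans p (sym q)))
    pigeonhole : XorY b₁ → XorY b₂ → XorY b₃ → ⊥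
    pigeonhole (inj₁ p) (inj₁ q) _        = same b₁≢b₂ p q
    pigeonhole (inj₂ p) (inj₂ q) _        = same b₁≢b₂ p q
    pigeonhole (inj₁ p) (inj₂ _) (inj₁ r) = same b₁≢b₃ p r
    pigeonhole (inj₂ p) (inj₁ _) (inj₂ r) = same b₁≢b₃ p r
    pigeonhole (inj₁ _) (inj₂ q) (inj₂ r) = same b₂≢b₃ q r
    pigeonhole (inj₂ _) (inj₁ q) (inj₁ r) = same b₂≢b₃ q r

contract-merged-row : ∀ {n} (t : Trigraph (suc (suc n))) u v (u≢v : u ≢ v) {a b} →
                      punchIn v a ≡ u → a ≢ b →
                      contract t u v u≢v a b ≡ merge (t u (punchIn v b)) (t v (punchIn v b))
contract-merged-row t u v u≢v {a} {b} a↦u a≢b with a Fin.≟ b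
... | yes a≡b = ⊥-elim (a≢b a≡b)
... | no _ with punchIn v a Fin.≟ u
...   | yes _ = refl
...   | no a↦̸u = ⊥-elim (a↦̸u a↦u)

Separated : ∀ {n} → Trigraph n → Set
Separated t = ∀ u v → u ≢ v → ∃[ w ] (w ≢ u × w ≢ v × t u w ≡ black × t v w ≡ none)

separated⇒redDeg≥2 : ∀ {n} (t : Trigraph (suc (suc n))) → Separated t →
                     ∀ u v (u≢v : u ≢ v) → 2 ≤ redDeg (contract t u v u≢v) (punchOut (u≢v ∘ sym))
separated⇒redDeg≥2 t sep u v u≢v with sep u v u≢v | sep v u (u≢v ∘ sym)
... | w₁ , w₁≢u , w₁≢v , uw₁ , vw₁ | w₂ , w₂≢v , w₂≢u , vw₂ , uw₂ =
  redDeg≥2 (contract t u v u≢v) x b₁≢b₂ (red-at w₁≢u w₁≢v (cong₂ merge uw₁ vw₁))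
                                       (red-at w₂≢u w₂≢v (cong₂ merge uw₂ vw₂))
  where
  x = punchOut (u≢v ∘ sym)
  x↦u : punchIn v x ≡ u
  x↦u = punchIn-punchOut (u≢v ∘ sym)
  red-at : ∀ {w} (w≢u : w ≢ u) (w≢v : w ≢ v) → merge (t u w) (t v w) ≡ red →
           contract t u v u≢v x (punchOut (w≢v ∘ sym)) ≡ red
  red-at {w} w≢u w≢v r = begin
    contract t u v u≢v x b                         ≡⟨ contract-merged-row t u v u≢v x↦u x≢b ⟩
    merge (t u (punchIn v b)) (t v (punchIn v b))  ≡⟨ cong (λ z → merge (t u z) (t v z)) b↦w ⟩
    merge (t u w) (t v w)                          ≡⟨ r ⟩
    red                                            ∎
    where
    open ≡-Reasoning
    b = punchOut (w≢v ∘ sym)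
    b↦w : punchIn v b ≡ w
    b↦w = punchIn-punchOut (w≢v ∘ sym)
    x≢b : x ≢ b
    x≢b x≡b = w≢u (trans (sym b↦w) (trans (cong (punchIn v) (sym x≡b)) x↦u))
  b₁≢b₂ : punchOut (w₁≢v ∘ sym) ≢ punchOut (w₂≢v ∘ sym)
  b₁≢b₂ eq with trans (sym (punchIn-punchOut (w₁≢v ∘ sym)))
                      (trans (cong (punchIn v) eq) (punchIn-punchOut (w₂≢v ∘ sym)))
  ... | refl with trans (sym uw₁) uw₂
  ...   | ()

separated⇒¬twwAtMost : ∀ {n} (t : Trigraph (suc (suc n))) → Separated t → ∀ d → d < 2 → ¬ TwwAtMost d t
separated⇒¬twwAtMost t sep d d<2 (_ , step _ u v u≢v bound _) =
  <⇒≱ d<2 (≤-trans (separated⇒redDeg≥2 t sep u v u≢v) (bound (punchOut (u≢v ∘ sym))))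

maxRedDeg≤? : ∀ {n} (t : Trigraph n) d → Dec (MaxRedDeg≤ t d)
maxRedDeg≤? t d = all? λ a → redDeg t a ≤? d

infixr 5 _∷_

data Contractions : ℕ → Set where
  []  : Contractions 1
  _∷_ : ∀ {n} → Fin (suc (suc n)) × Fin (suc (suc n)) → Contractions (suc n) → Contractions (suc (suc n))

contrSeq? : ∀ {n} d (t : Trigraph n) → Contractions n → Maybe (ContrSeq d t)
contrSeq? d t [] = just (done t)
contrSeq? d t ((u , v) ∷ cs) with u Fin.≟ v
... | yes _ = nothing
... | no u≢v with maxRedDeg≤? (contract t u v u≢v) d | contrSeq? d (contract t u v u≢v) cs
...   | yes bound | just seq = just (step t u v u≢v bound seq)
...   | _         | _        = nothing

-- Trigraphs on initial segments of ℕ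

lift : ∀ {n} → (ℕ → ℕ → Col) → Trigraph n
lift f a b = f (toℕ a) (toℕ b)

Separator : ℕ → (ℕ → ℕ → Col) → ℕ → ℕ → Set
Separator n f U V = ∃[ w ] (w < n × w ≢ U × w ≢ V × f U w ≡ black × f V w ≡ none)

lift-separated : ∀ {n} (f : ℕ → ℕ → Col) →
                 (∀ {U V} → U < n → V < n → U ≢ V → Separator n f U V) → Separated (lift {n} f)
lift-separated f separator u v u≢v
  with separator (toℕ<n u) (toℕ<n v) (u≢v ∘ toℕ-injective)
... | w , w<n , w≢u , w≢v , uw , vw = fromℕ< w<n , w≢u ∘ on-toℕ , w≢v ∘ on-toℕ , at uw , at vw
  where
  w-toℕ : toℕ (fromℕ< w<n) ≡ w
  w-toℕ = toℕ-fromℕ< w<n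
  on-toℕ : ∀ {x} → fromℕ< w<n ≡ x → w ≡ toℕ x
  on-toℕ refl = sym w-toℕ
  at : ∀ {x c} → f x w ≡ c → f x (toℕ (fromℕ< w<n)) ≡ c
  at {x} = subst (λ y → f x y ≡ _) (sym w-toℕ)

punchIn-fromℕ : ∀ {n} (a : Fin n) → punchIn (fromℕ n) a ≡ inject₁ a
punchIn-fromℕ zero    = refl
punchIn-fromℕ (suc a) = cong suc (punchIn-fromℕ a)

toℕ-punchIn-fromℕ : ∀ {n} (a : Fin n) → toℕ (punchIn (fromℕ n) a) ≡ toℕ a
toℕ-punchIn-fromℕ a = trans (cong toℕ (punchIn-fromℕ a)) (toℕ-inject₁ a)

penultimate : ∀ m → Fin (suc (suc m))
penultimate m = inject₁ (fromℕ m)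

penultimate≢last : ∀ m → penultimate m ≢ fromℕ (suc m)
penultimate≢last m = fromℕ≢inject₁ ∘ sym

contractLastTwo : ∀ {m} → Trigraph (suc (suc m)) → Trigraph (suc m)
contractLastTwo {m} t = contract t (penultimate m) (fromℕ (suc m)) (penultimate≢last m)

contrSeq-last-two : ∀ {d m} {t : Trigraph (suc (suc m))} {t′ : Trigraph (suc m)} →
                    contractLastTwo t ≗₂ t′ → MaxRedDeg≤ t′ d → ContrSeq d t′ → ContrSeq d t
contrSeq-last-two {m = m} {t} eq bound seq =
  step t (penultimate m) (fromℕ (suc m)) (penultimate≢last m) (maxRedDeg≤-cong (≗₂-sym eq) bound) (contrSeq-cong (≗₂-sym eq) seq)

toℕ-penultimate : ∀ m → toℕ (penultimate m) ≡ m
toℕ-penultimate m = trans (toℕ-inject₁ (fromℕ m)) (toℕ-fromℕ m)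

punchIn-penultimate : ∀ {m} {a : Fin (suc m)} → punchIn (fromℕ (suc m)) a ≡ penultimate m → toℕ a ≡ m
punchIn-penultimate {m} {a} eq =
  trans (sym (toℕ-punchIn-fromℕ a)) (trans (cong toℕ eq) (toℕ-penultimate m))

punchIn-not-penultimate : ∀ {m} {a : Fin (suc m)} → punchIn (fromℕ (suc m)) a ≢ penultimate m → toℕ a < m
punchIn-not-penultimate {m} {a} neq = ≤∧≢⇒< (s≤s⁻¹ (toℕ<n a)) λ a≡m →
  neq (toℕ-injective (trans (toℕ-punchIn-fromℕ a) (trans a≡m (sym (toℕ-penultimate m)))))

contract-last-two : ∀ {m} (f g : ℕ → ℕ → Col) →
  (∀ A B → g A B ≡ g B A) → (∀ {A} → A ≤ m → g A A ≡ none) →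
  (∀ {A B} → A < m → B < m → f A B ≡ g A B) →
  (∀ {B} → B < m → merge (f m B) (f (suc m) B) ≡ g m B) →
  contractLastTwo (lift f) ≗₂ lift {suc m} g
contract-last-two {m} f g g-sym g-irrefl agree merged a b with a Fin.≟ b
... | yes refl = sym (g-irrefl (s≤s⁻¹ (toℕ<n a)))
... | no a≢b with punchIn (fromℕ (suc m)) a Fin.≟ penultimate m
                | punchIn (fromℕ (suc m)) b Fin.≟ penultimate m
...   | yes a↦ | _
  rewrite toℕ-penultimate m | toℕ-fromℕ (suc m) | toℕ-punchIn-fromℕ b | punchIn-penultimate a↦ =
  merged (punchIn-not-penultimate λ b↦ →
    a≢b (toℕ-injective (trans (punchIn-penultimate a↦) (sym (punchIn-penultimate b↦)))))
...   | no a↦̸ | yes b↦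
  rewrite toℕ-penultimate m | toℕ-fromℕ (suc m) | toℕ-punchIn-fromℕ a | punchIn-penultimate b↦ =
  trans (merged (punchIn-not-penultimate a↦̸)) (g-sym m (toℕ a))
...   | no a↦̸ | no b↦̸ rewrite toℕ-punchIn-fromℕ a | toℕ-punchIn-fromℕ b =
  agree (punchIn-not-penultimate a↦̸) (punchIn-not-penultimate b↦̸)

-- Adjacency in G

≡ᵇ-refl : ∀ n → (n ≡ᵇ n) ≡ true
≡ᵇ-refl n = dec-true (n ≟ n) refl

≢⇒≡ᵇ-false : ∀ {m n} → m ≢ n → (m ≡ᵇ n) ≡ false
≢⇒≡ᵇ-false {m} {n} = dec-false (m ≟ n)

≰⇒≤ᵇ-false : ∀ {m n} → ¬ m ≤ n → (m ≤ᵇ n) ≡ false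
≰⇒≤ᵇ-false {m} {n} = dec-false (m ≤? n)

∧-≡ᵇ-false : ∀ {m n x y} → (m ≡ n → x ≢ y) → ((m ≡ᵇ n) ∧ (x ≡ᵇ y)) ≡ false
∧-≡ᵇ-false {m} {n} m≡n⇒x≢y with m ≟ n
... | yes m≡n rewrite ≢⇒≡ᵇ-false (m≡n⇒x≢y m≡n) = ∧-zeroʳ (m ≡ᵇ n)
... | no m≢n  rewrite ≢⇒≡ᵇ-false m≢n = refl

core<9+ : ∀ {c} i → c ≤ 8 → c < 9 + i
core<9+ i c≤8 = ≤-trans (s≤s c≤8) (m≤m+n 9 i)

col : Bool → Col
col b = if b then black else none

Gᴺ : ℕ → ℕ → ℕ → Col
Gᴺ k a b = col (dirEdge k a b ∨ dirEdge k b a)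

Gᴺ-sym : ∀ k a b → Gᴺ k a b ≡ Gᴺ k b a
Gᴺ-sym k a b = cong col (∨-comm (dirEdge k a b) (dirEdge k b a))

coreAdj : ℕ → ℕ → Bool
coreAdj a b = baseEdge a b ∨ baseEdge b a

pathEdge-core-core : ∀ K {c c′} → c ≤ 8 → c′ ≤ 8 → pathEdge (suc K) c c′ ≡ false
pathEdge-core-core K {c} {c′} c≤8 c′≤8
  rewrite ≢⇒≡ᵇ-false {c′} {9} (<⇒≢ (s≤s c′≤8))
        | ≰⇒≤ᵇ-false {9} {c} (<⇒≱ (s≤s c≤8))
        | ≢⇒≡ᵇ-false {c} {9 + K} (<⇒≢ (core<9+ K c≤8))
        | ∧-zeroʳ (c ≡ᵇ 0) = refl

Gᴺ-core-core : ∀ K {c c′} → c ≤ 8 → c′ ≤ 8 → Gᴺ (suc K) c c′ ≡ col (coreAdj c c′)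
Gᴺ-core-core K {c} {c′} c≤8 c′≤8
  rewrite pathEdge-core-core K c≤8 c′≤8 | pathEdge-core-core K c′≤8 c≤8
        | ∨-identityʳ (baseEdge c c′) | ∨-identityʳ (baseEdge c′ c) = refl

baseEdge-to-path : ∀ a i → baseEdge a (9 + i) ≡ false
baseEdge-to-path 0 i = refl
baseEdge-to-path 1 i = refl
baseEdge-to-path 2 i = refl
baseEdge-to-path 3 i = refl
baseEdge-to-path 4 i = refl
baseEdge-to-path 5 i = refl
baseEdge-to-path 6 i = refl
baseEdge-to-path 7 i = refl
baseEdge-to-path 8 i = refl
baseEdge-to-path (suc (suc (suc (suc (suc (suc (suc (suc (suc a))))))))) i = refl

Gᴺ-path-core : ∀ K i {c} → c ≤ 8 →
               Gᴺ (suc K) (9 + i) c ≡ col (((c ≡ᵇ 0) ∧ (i ≡ᵇ 0)) ∨ ((i ≡ᵇ K) ∧ (c ≡ᵇ 1)))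
Gᴺ-path-core K i {c} c≤8
  rewrite ≢⇒≡ᵇ-false {c} {10 + i} (<⇒≢ (core<9+ (suc i) c≤8))
        | baseEdge-to-path c i
        | ≰⇒≤ᵇ-false {9} {c} (<⇒≱ (s≤s c≤8))
        | ∧-zeroʳ (c ≡ᵇ 9 + K)
        | ∨-identityʳ ((c ≡ᵇ 0) ∧ (i ≡ᵇ 0)) = cong col (∨-comm ((i ≡ᵇ K) ∧ (c ≡ᵇ 1)) _)

dirEdge-path-path : ∀ K i {j} → j ≤ K → dirEdge (suc K) (9 + i) (9 + j) ≡ (j ≡ᵇ suc i)
dirEdge-path-path K i {j} j≤K with j ≡ᵇ suc i in j≟i+1
... | false = ∧-zeroʳ (i ≡ᵇ K)
... | true rewrite ≡ᵇ⇒≡ j (suc i) (subst T (sym j≟i+1) _) | dec-true (i <? K) j≤K = refl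

Gᴺ-path-path : ∀ K {i j} → i ≤ K → j ≤ K →
               Gᴺ (suc K) (9 + i) (9 + j) ≡ col ((j ≡ᵇ suc i) ∨ (i ≡ᵇ suc j))
Gᴺ-path-path K {i} {j} i≤K j≤K rewrite dirEdge-path-path K i j≤K | dirEdge-path-path K j i≤K = refl

data Vertex (K : ℕ) : ℕ → Set where
  core : ∀ {c} → c ≤ 8 → Vertex K c
  path : ∀ {i} → i ≤ K → Vertex K (9 + i)

vertex : ∀ K {A} → A ≤ 9 + K → Vertex K A
vertex K {A} A≤ with A ≤? 8
... | yes A≤8 = core A≤8
... | no A≰8  = subst (Vertex K) (m+[n∸m]≡n (≰⇒> A≰8)) (path (m≤n+o⇒m∸n≤o A 9 A≤))

-- The neighbours of the path vertex 9 + i of G (suc K), towards 0 and towards 1.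
prev : ℕ → ℕ
prev zero    = 0
prev (suc i) = 9 + i

next : ℕ → ℕ → ℕ
next K i = if i ≡ᵇ K then 1 else 10 + i

next-last : ∀ K → next K K ≡ 1
next-last K rewrite ≡ᵇ-refl K = refl

next-inner : ∀ {K i} → i ≢ K → next K i ≡ 10 + i
next-inner i≢K rewrite ≢⇒≡ᵇ-false i≢K = refl

prev-adj : ∀ K {i} → i ≤ K → Gᴺ (suc K) (9 + i) (prev i) ≡ black
prev-adj K {zero}  _   = Gᴺ-path-core K 0 z≤n
prev-adj K {suc i} i<K
  rewrite Gᴺ-path-path K i<K (≤-trans (n≤1+n i) i<K) | ≡ᵇ-refl i | ∨-zeroʳ (i ≡ᵇ suc (suc i)) = refl

next-adj : ∀ K {i} → i ≤ K → Gᴺ (suc K) (9 + i) (next K i) ≡ black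
next-adj K {i} i≤K with i ≟ K
... | yes refl rewrite next-last i | Gᴺ-path-core i i (s≤s z≤n) | ≡ᵇ-refl i = refl
... | no i≢K rewrite next-inner i≢K | Gᴺ-path-path K i≤K (≤∧≢⇒< i≤K i≢K) | ≡ᵇ-refl i = refl

path-nonadj : ∀ K {i B} → i ≤ K → B ≤ 9 + K → B ≢ prev i → B ≢ next K i → Gᴺ (suc K) (9 + i) B ≡ none
path-nonadj K {i} i≤K B≤ B≢prev B≢next with vertex K B≤
... | core {c} c≤8
  rewrite Gᴺ-path-core K i c≤8
        | ∧-≡ᵇ-false {c} {0} {i} {0} (λ { refl refl → B≢prev refl })
        | ∧-≡ᵇ-false {i} {K} {c} {1} (λ { refl refl → B≢next (sym (next-last i)) }) = refl
... | path {j} j≤K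
  rewrite Gᴺ-path-path K i≤K j≤K
        | ≢⇒≡ᵇ-false {j} {suc i} (λ { refl → B≢next (sym (next-inner (<⇒≢ j≤K))) })
        | ≢⇒≡ᵇ-false {i} {suc j} (λ { refl → B≢prev refl }) = refl

path-row : ∀ K {i B} → i ≤ K → B ≤ 9 + K → Gᴺ (suc K) (9 + i) B ≡ col ((B ≡ᵇ prev i) ∨ (B ≡ᵇ next K i))
path-row K {i} {B} i≤K B≤ with B ≟ prev i | B ≟ next K i
... | yes refl | _    rewrite ≡ᵇ-refl (prev i) = prev-adj K i≤K
... | no _ | yes refl rewrite ≡ᵇ-refl (next K i) | ∨-zeroʳ (next K i ≡ᵇ prev i) = next-adj K i≤K
... | no B≢p | no B≢n rewrite ≢⇒≡ᵇ-false B≢p | ≢⇒≡ᵇ-false B≢n = path-nonadj K i≤K B≤ B≢p B≢n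

for-core : (P : ℕ → Set) → (∀ (c : Fin 9) → P (toℕ c)) → ∀ {c} → c ≤ 8 → P c
for-core P h c≤8 = subst P (toℕ-fromℕ< (s≤s c≤8)) (h (fromℕ< (s≤s c≤8)))

core≤8 : (c : Fin 9) → toℕ c ≤ 8
core≤8 c = s≤s⁻¹ (toℕ<n c)

coreAdj-irrefl : ∀ (c : Fin 9) → coreAdj (toℕ c) (toℕ c) ≡ false
coreAdj-irrefl = from-yes (all? λ (c : Fin 9) → coreAdj (toℕ c) (toℕ c) Bool.≟ false)

CoreSeparates : ℕ → ℕ → ℕ → Set
CoreSeparates c c′ w = w ≢ c × w ≢ c′ × coreAdj c w ≡ true × coreAdj c′ w ≡ false

coreAdj-separated : ∀ (c c′ : Fin 9) → toℕ c ≢ toℕ c′ →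
                    Σ[ w ∈ Fin 9 ] CoreSeparates (toℕ c) (toℕ c′) (toℕ w)
coreAdj-separated = from-yes (all? λ (c : Fin 9) → all? λ (c′ : Fin 9) →
  ¬? (toℕ c ≟ toℕ c′) →-dec any? λ (w : Fin 9) →
  ¬? (toℕ w ≟ toℕ c) ×-dec ¬? (toℕ w ≟ toℕ c′) ×-dec
  coreAdj (toℕ c) (toℕ w) Bool.≟ true ×-dec coreAdj (toℕ c′) (toℕ w) Bool.≟ false)

coreAdj-off-branch : ∀ (c : Fin 9) →
  Σ[ w ∈ Fin 9 ] (toℕ w ≢ toℕ c × toℕ w ≢ 0 × toℕ w ≢ 1 × coreAdj (toℕ c) (toℕ w) ≡ true)
coreAdj-off-branch = from-yes (all? λ (c : Fin 9) → any? λ (w : Fin 9) →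
  ¬? (toℕ w ≟ toℕ c) ×-dec ¬? (toℕ w ≟ 0) ×-dec ¬? (toℕ w ≟ 1) ×-dec coreAdj (toℕ c) (toℕ w) Bool.≟ true)

Avoids : ℕ → ℕ → Set
Avoids c x = c ≢ x × coreAdj c x ≡ false

avoids-0-or-1 : ∀ (c : Fin 9) → Avoids (toℕ c) 0 ⊎ Avoids (toℕ c) 1
avoids-0-or-1 = from-yes (all? λ (c : Fin 9) →
  (¬? (toℕ c ≟ 0) ×-dec coreAdj (toℕ c) 0 Bool.≟ false) ⊎-dec
  (¬? (toℕ c ≟ 1) ×-dec coreAdj (toℕ c) 1 Bool.≟ false))

-- Lower bound

prev<9+ : ∀ i → prev i < 9 + i
prev<9+ zero    = s≤s z≤n
prev<9+ (suc i) = n<1+n (9 + i)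

prev≤9+ : ∀ {K i} → i ≤ K → prev i ≤ 9 + K
prev≤9+ {i = i} i≤K = <⇒≤ (<-≤-trans (prev<9+ i) (+-monoʳ-≤ 9 i≤K))

next-cases : ∀ K i → next K i ≡ 1 ⊎ next K i ≡ 10 + i
next-cases K i with i ≟ K
... | yes refl = inj₁ (next-last i)
... | no i≢K   = inj₂ (next-inner i≢K)

next<10+ : ∀ {K i} → i ≤ K → next K i < 10 + K
next<10+ {K} {i} i≤K with i ≟ K
... | yes refl rewrite next-last i = s≤s (s≤s z≤n)
... | no i≢K   rewrite next-inner i≢K = +-monoʳ-< 10 (≤∧≢⇒< i≤K i≢K)

next≤9+ : ∀ {K i} → i ≤ K → next K i ≤ 9 + K
next≤9+ i≤K = s≤s⁻¹ (next<10+ i≤K)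

next≢9+ : ∀ K i → next K i ≢ 9 + i
next≢9+ K i with next-cases K i
... | inj₁ n≡1    rewrite n≡1    = λ ()
... | inj₂ n≡10+i rewrite n≡10+i = 1+n≢n

core≢prev : ∀ {c} i → c ≤ 8 → c ≢ 0 → c ≢ prev i
core≢prev zero    _   c≢0 = c≢0
core≢prev (suc i) c≤8 _   = <⇒≢ (core<9+ i c≤8)

core≢next : ∀ {c} K i → c ≤ 8 → c ≢ 1 → c ≢ next K i
core≢next K i c≤8 c≢1 with next-cases K i
... | inj₁ n≡1    rewrite n≡1    = c≢1
... | inj₂ n≡10+i rewrite n≡10+i = <⇒≢ (core<9+ (suc i) c≤8)

prev-injective : ∀ {i j} → prev i ≡ prev j → i ≡ j
prev-injective {zero}  {zero}  _  = refl
prev-injective {suc i} {suc j} eq = cong suc (+-cancelˡ-≡ 9 i j eq)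

next-injective : ∀ {K i j} → i ≤ K → j ≤ K → next K i ≡ next K j → i ≡ j
next-injective {K} {i} {j} i≤K j≤K eq with i ≟ K | j ≟ K
... | yes i≡K | yes j≡K = trans i≡K (sym j≡K)
... | yes refl | no j≢K rewrite next-last i | next-inner j≢K = case eq of λ ()
... | no i≢K | yes refl rewrite next-last j | next-inner i≢K = case eq of λ ()
... | no i≢K | no j≢K rewrite next-inner i≢K | next-inner j≢K = +-cancelˡ-≡ 10 i j eq

prev≢next : ∀ {K i j} → i ≤ suc j → prev i ≢ next K j
prev≢next {K} {i} {j} i≤1+j p≡n with i | next-cases K j
... | zero  | inj₁ n≡1    = case trans p≡n n≡1 of λ ()
... | zero  | inj₂ n≡10+j = case trans p≡n n≡10+j of λ ()
... | suc _ | inj₁ n≡1    = case trans p≡n n≡1 of λ ()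
... | suc i | inj₂ n≡10+j = <⇒≢ i≤1+j (+-cancelˡ-≡ 9 i (suc j) (trans p≡n n≡10+j))

GSeparator : ℕ → ℕ → ℕ → Set
GSeparator K = Separator (10 + K) (Gᴺ (suc K))

prev-separator : ∀ K {i V} → i ≤ K → prev i ≢ V → Gᴺ (suc K) V (prev i) ≡ none →
                 GSeparator K (9 + i) V
prev-separator K {i} i≤K p≢V V≁p =
  prev i , <-trans (prev<9+ i) (s≤s (+-monoʳ-≤ 9 i≤K)) , <⇒≢ (prev<9+ i) , p≢V , prev-adj K i≤K , V≁p

next-separator : ∀ K {i V} → i ≤ K → next K i ≢ V → Gᴺ (suc K) V (next K i) ≡ none →
                 GSeparator K (9 + i) V
next-separator K {i} i≤K n≢V V≁n = next K i , next<10+ i≤K , next≢9+ K i , n≢V , next-adj K i≤K , V≁n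

core-core-separator : ∀ K {c c′} → c ≤ 8 → c′ ≤ 8 → c ≢ c′ → GSeparator K c c′
core-core-separator K {c} {c′} c≤8 c′≤8 =
  for-core (λ c → c ≢ c′ → GSeparator K c c′)
    (λ c → for-core (λ c′ → toℕ c ≢ c′ → GSeparator K (toℕ c) c′) (from-core c) c′≤8) c≤8
  where
  from-core : ∀ c c′ → toℕ c ≢ toℕ c′ → GSeparator K (toℕ c) (toℕ c′)
  from-core c c′ c≢c′ with coreAdj-separated c c′ c≢c′
  ... | w , w≢c , w≢c′ , cw , c′w =
    toℕ w , core<9+ (suc K) (core≤8 w) , w≢c , w≢c′ ,
    trans (Gᴺ-core-core K (core≤8 c) (core≤8 w)) (cong col cw) ,
    trans (Gᴺ-core-core K (core≤8 c′) (core≤8 w)) (cong col c′w)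

core-path-separator : ∀ K {c j} → c ≤ 8 → j ≤ K → GSeparator K c (9 + j)
core-path-separator K {j = j} c≤8 j≤K =
  for-core (λ c → GSeparator K c (9 + j)) from-core c≤8
  where
  from-core : ∀ c → GSeparator K (toℕ c) (9 + j)
  from-core c with coreAdj-off-branch c
  ... | w , w≢c , w≢0 , w≢1 , cw =
    toℕ w , core<9+ (suc K) w≤8 , w≢c , <⇒≢ (core<9+ j w≤8) ,
    trans (Gᴺ-core-core K (core≤8 c) w≤8) (cong col cw) ,
    path-nonadj K j≤K (<⇒≤ (core<9+ K w≤8)) (core≢prev j w≤8 w≢0) (core≢next K j w≤8 w≢1)
    where
    w≤8 = core≤8 w

path-core-separator : ∀ K {i c} → i ≤ K → c ≤ 8 → GSeparator K (9 + i) c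
path-core-separator K {i} i≤K = for-core (GSeparator K (9 + i)) from-core
  where
  from-core : ∀ c → GSeparator K (9 + i) (toℕ c)
  from-core c with avoids-0-or-1 c
  ... | inj₁ (c≢0 , c≁0) = prev-separator K i≤K (≢-sym (core≢prev i c≤8 c≢0)) (c≁prev i i≤K)
    where
    c≤8 = core≤8 c
    c≁prev : ∀ i → i ≤ K → Gᴺ (suc K) (toℕ c) (prev i) ≡ none
    c≁prev zero    _   = trans (Gᴺ-core-core K c≤8 z≤n) (cong col c≁0)
    c≁prev (suc i) i<K = trans (Gᴺ-sym (suc K) (toℕ c) (9 + i))
      (path-nonadj K (<⇒≤ i<K) (<⇒≤ (core<9+ K c≤8)) (core≢prev i c≤8 c≢0)
        (λ c≡n → <⇒≢ (core<9+ (suc i) c≤8) (trans c≡n (next-inner (<⇒≢ i<K)))))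
  ... | inj₂ (c≢1 , c≁1) = next-separator K i≤K (≢-sym (core≢next K i c≤8 c≢1)) c≁next
    where
    c≤8 = core≤8 c
    c≁next : Gᴺ (suc K) (toℕ c) (next K i) ≡ none
    c≁next with i ≟ K
    ... | yes refl rewrite next-last i = trans (Gᴺ-core-core K c≤8 (s≤s z≤n)) (cong col c≁1)
    ... | no i≢K   rewrite next-inner i≢K = trans (Gᴺ-sym (suc K) (toℕ c) (9 + suc i))
      (path-nonadj K (≤∧≢⇒< i≤K i≢K) (<⇒≤ (core<9+ K c≤8)) (<⇒≢ (core<9+ i c≤8))
                   (core≢next K (suc i) c≤8 c≢1))

path-path-separator : ∀ K {i j} → i ≤ K → j ≤ K → i ≢ j → GSeparator K (9 + i) (9 + j)
path-path-separator K {i} {j} i≤K j≤K i≢j with <-cmp i j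
... | tri< i<j _ _ =
  prev-separator K i≤K (<⇒≢ (<-trans (prev<9+ i) (+-monoʳ-< 9 i<j)))
    (path-nonadj K j≤K (prev≤9+ i≤K) (i≢j ∘ prev-injective)
                 (prev≢next (≤-trans (<⇒≤ i<j) (n≤1+n j))))
... | tri≈ _ i≡j _ = ⊥-elim (i≢j i≡j)
... | tri> _ _ j<i =
  next-separator K i≤K next≢
    (path-nonadj K j≤K (next≤9+ i≤K) (≢-sym (prev≢next (≤-trans (<⇒≤ j<i) (n≤1+n i))))
                 (i≢j ∘ next-injective i≤K j≤K))
  where
  next≢ : next K i ≢ 9 + j
  next≢ with next-cases K i
  ... | inj₁ n≡1    rewrite n≡1    = λ ()
  ... | inj₂ n≡10+i rewrite n≡10+i = >⇒≢ (s≤s (+-monoʳ-≤ 9 (<⇒≤ j<i)))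

G-separated : ∀ K → Separated (G (suc K))
G-separated K = lift-separated (Gᴺ (suc K)) separator
  where
  separator : ∀ {U V} → U < 10 + K → V < 10 + K → U ≢ V → GSeparator K U V
  separator U< V< U≢V with vertex K (s≤s⁻¹ U<) | vertex K (s≤s⁻¹ V<)
  ... | core c≤8 | core c′≤8 = core-core-separator K c≤8 c′≤8 U≢V
  ... | core c≤8 | path j≤K  = core-path-separator K c≤8 j≤K
  ... | path i≤K | core c≤8  = path-core-separator K i≤K c≤8
  ... | path i≤K | path j≤K  = path-path-separator K i≤K j≤K (U≢V ∘ cong (9 +_))

-- Upper bound

redden : Col → Col
redden black = red
redden c     = c

reddenAt : ℕ → (ℕ → ℕ → Col) → ℕ → ℕ → Col
reddenAt x f a b = if (a ≡ᵇ x) ∨ (b ≡ᵇ x) then redden (f a b) else f a b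

-- Contracting the last two path vertices of G (2 + K), or of Tᴺ (1 + K), yields Tᴺ K.
Tᴺ : ℕ → ℕ → ℕ → Col
Tᴺ K = reddenAt (9 + K) (Gᴺ (suc K))

Gᴺ-irrefl : ∀ K {A} → A ≤ 9 + K → Gᴺ (suc K) A A ≡ none
Gᴺ-irrefl K A≤ with vertex K A≤
... | core c≤8 =
  trans (Gᴺ-core-core K c≤8 c≤8) (cong col (for-core (λ c → coreAdj c c ≡ false) coreAdj-irrefl c≤8))
... | path {i} i≤K = path-nonadj K i≤K A≤ (>⇒≢ (prev<9+ i)) (≢-sym (next≢9+ K i))

path-row-shorten : ∀ K {i B} → i < K → B ≤ 8 + K → Gᴺ (2 + K) (9 + i) B ≡ Gᴺ (1 + K) (9 + i) B
path-row-shorten K {i} i<K B≤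
  rewrite path-row (suc K) (≤-trans (<⇒≤ i<K) (n≤1+n K)) (≤-trans B≤ (≤-trans (n≤1+n _) (n≤1+n _)))
        | path-row K (<⇒≤ i<K) (≤-trans B≤ (n≤1+n _))
        | next-inner {suc K} {i} (<⇒≢ (≤-trans i<K (n≤1+n K)))
        | next-inner {K} {i} (<⇒≢ i<K) = refl

Gᴺ-shorten : ∀ K {A B} → A ≤ 8 + K → B ≤ 8 + K → Gᴺ (2 + K) A B ≡ Gᴺ (1 + K) A B
Gᴺ-shorten K {A} {B} A≤ B≤ with vertex K (≤-trans A≤ (n≤1+n _)) | vertex K (≤-trans B≤ (n≤1+n _))
... | core c≤8 | core c′≤8 = trans (Gᴺ-core-core (suc K) c≤8 c′≤8) (sym (Gᴺ-core-core K c≤8 c′≤8))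
... | core c≤8 | path {j} _ =
  trans (Gᴺ-sym (2 + K) A B)
        (trans (path-row-shorten K (+-cancelˡ-≤ 8 (suc j) K B≤) A≤) (Gᴺ-sym (1 + K) B A))
... | path {i} _ | _ = path-row-shorten K (+-cancelˡ-≤ 8 (suc i) K A≤) B≤

reddenAt-at : ∀ x (f : ℕ → ℕ → Col) b → reddenAt x f x b ≡ redden (f x b)
reddenAt-at x f b rewrite ≡ᵇ-refl x = refl

reddenAt-off : ∀ {x a b} (f : ℕ → ℕ → Col) → a ≢ x → b ≢ x → reddenAt x f a b ≡ f a b
reddenAt-off f a≢x b≢x rewrite ≢⇒≡ᵇ-false a≢x | ≢⇒≡ᵇ-false b≢x = refl

reddenAt-sym : ∀ x {f : ℕ → ℕ → Col} → (∀ a b → f a b ≡ f b a) →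
               ∀ a b → reddenAt x f a b ≡ reddenAt x f b a
reddenAt-sym x {f} f-sym a b rewrite ∨-comm (a ≡ᵇ x) (b ≡ᵇ x) | f-sym a b = refl

reddenAt-irrefl : ∀ x {f : ℕ → ℕ → Col} {a} → f a a ≡ none → reddenAt x f a a ≡ none
reddenAt-irrefl x {a = a} faa rewrite faa with (a ≡ᵇ x) ∨ (a ≡ᵇ x)
... | true  = refl
... | false = refl

col≢red : ∀ p → col p ≢ red
col≢red true  ()
col≢red false ()

reddenAt-red : ∀ {x a b} (f : ℕ → ℕ → Col) → (∀ a b → f a b ≢ red) →
               reddenAt x f a b ≡ red → a ≡ x ⊎ b ≡ x
reddenAt-red {x} {a} {b} f no-red r with a ≟ x | b ≟ x
... | yes a≡x | _       = inj₁ a≡x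
... | no _    | yes b≡x = inj₂ b≡x
... | no a≢x  | no b≢x  = ⊥-elim (no-red a b (trans (sym (reddenAt-off f a≢x b≢x)) r))

merge-col : ∀ p q → p ∧ q ≡ false → merge (col p) (col q) ≡ redden (col (p ∨ q))
merge-col true  false _ = refl
merge-col false true  _ = refl
merge-col false false _ = refl

merge-col-redden : ∀ p q → merge (col p) (redden (col q)) ≡ redden (col (p ∨ q))
merge-col-redden true  true  = refl
merge-col-redden true  false = refl
merge-col-redden false true  = refl
merge-col-redden false false = refl

prev≢1 : ∀ i → prev i ≢ 1
prev≢1 zero    ()
prev≢1 (suc i) ()

last-row : ∀ K {B} → B ≤ 9 + K → Gᴺ (1 + K) (9 + K) B ≡ col ((B ≡ᵇ prev K) ∨ (B ≡ᵇ 1))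
last-row K B≤ rewrite path-row K ≤-refl B≤ | next-last K = refl

penultimate-row : ∀ K {B} → B ≤ 8 + K → Gᴺ (2 + K) (9 + K) B ≡ col (B ≡ᵇ prev K)
penultimate-row K {B} B≤
  rewrite path-row (suc K) (n≤1+n K) (≤-trans B≤ (≤-trans (n≤1+n _) (n≤1+n _)))
        | next-inner {suc K} {K} (<⇒≢ (n<1+n K))
        | ≢⇒≡ᵇ-false {B} {10 + K} (<⇒≢ (s≤s (≤-trans B≤ (n≤1+n _))))
        = cong col (∨-identityʳ _)

ultimate-row : ∀ K {B} → B ≤ 8 + K → Gᴺ (2 + K) (10 + K) B ≡ col (B ≡ᵇ 1)
ultimate-row K {B} B≤
  rewrite path-row (suc K) {suc K} ≤-refl (≤-trans B≤ (≤-trans (n≤1+n _) (n≤1+n _)))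
        | next-last (suc K)
        | ≢⇒≡ᵇ-false {B} {9 + K} (<⇒≢ (s≤s B≤)) = refl

G-merged-row : ∀ K {B} → B < 9 + K →
               merge (Gᴺ (2 + K) (9 + K) B) (Gᴺ (2 + K) (10 + K) B) ≡ Tᴺ K (9 + K) B
G-merged-row K {B} B<
  rewrite penultimate-row K (s≤s⁻¹ B<) | ultimate-row K (s≤s⁻¹ B<)
        | reddenAt-at (9 + K) (Gᴺ (suc K)) B | last-row K (<⇒≤ B<) =
  merge-col (B ≡ᵇ prev K) (B ≡ᵇ 1) (∧-≡ᵇ-false {B} {prev K} {B} {1} λ { refl → prev≢1 K })

T-merged-row : ∀ K {B} → B < 9 + K →
               merge (Tᴺ (1 + K) (9 + K) B) (Tᴺ (1 + K) (10 + K) B) ≡ Tᴺ K (9 + K) B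
T-merged-row K {B} B<
  rewrite reddenAt-off {10 + K} (Gᴺ (2 + K)) (<⇒≢ (n<1+n (9 + K))) (<⇒≢ (<-trans B< (n<1+n _)))
        | reddenAt-at (10 + K) (Gᴺ (2 + K)) B
        | penultimate-row K (s≤s⁻¹ B<) | ultimate-row K (s≤s⁻¹ B<)
        | reddenAt-at (9 + K) (Gᴺ (suc K)) B | last-row K (<⇒≤ B<) =
  merge-col-redden (B ≡ᵇ prev K) (B ≡ᵇ 1)

Tᴺ-sym : ∀ K A B → Tᴺ K A B ≡ Tᴺ K B A
Tᴺ-sym K = reddenAt-sym (9 + K) (Gᴺ-sym (suc K))

Tᴺ-irrefl : ∀ K {A} → A ≤ 9 + K → Tᴺ K A A ≡ none
Tᴺ-irrefl K {A} A≤ = reddenAt-irrefl (9 + K) {Gᴺ (suc K)} {A} (Gᴺ-irrefl K A≤)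

Tᴺ-below : ∀ K {A B} → A < 9 + K → B < 9 + K → Tᴺ K A B ≡ Gᴺ (suc K) A B
Tᴺ-below K A< B< = reddenAt-off (Gᴺ (suc K)) (<⇒≢ A<) (<⇒≢ B<)

G-contract-last-two : ∀ K → contractLastTwo (G (2 + K)) ≗₂ lift (Tᴺ K)
G-contract-last-two K = contract-last-two (Gᴺ (2 + K)) (Tᴺ K) (Tᴺ-sym K) (Tᴺ-irrefl K)
  (λ A< B< → trans (Gᴺ-shorten K (s≤s⁻¹ A<) (s≤s⁻¹ B<)) (sym (Tᴺ-below K A< B<)))
  (G-merged-row K)

T-contract-last-two : ∀ K → contractLastTwo (lift (Tᴺ (1 + K))) ≗₂ lift (Tᴺ K)
T-contract-last-two K = contract-last-two (Tᴺ (1 + K)) (Tᴺ K) (Tᴺ-sym K) (Tᴺ-irrefl K)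
  (λ A< B< → trans (Tᴺ-below (suc K) (<-trans A< (n<1+n _)) (<-trans B< (n<1+n _)))
               (trans (Gᴺ-shorten K (s≤s⁻¹ A<) (s≤s⁻¹ B<)) (sym (Tᴺ-below K A< B<))))
  (T-merged-row K)

G-maxRedDeg≤ : ∀ k → MaxRedDeg≤ (G k) 2
G-maxRedDeg≤ k a = redDeg≤2 (G k) a 0 0 λ b r → ⊥-elim (col≢red _ r)

Tᴺ-last-red : ∀ K {B} → B ≤ 9 + K → Tᴺ K (9 + K) B ≡ red → B ≡ prev K ⊎ B ≡ 1
Tᴺ-last-red K {B} B≤ r with B ≟ prev K | B ≟ 1
... | yes B≡p | _       = inj₁ B≡p
... | no _    | yes B≡1 = inj₂ B≡1
... | no B≢p  | no B≢1  =
  case trans (sym (cong redden nonadj)) (trans (sym (reddenAt-at (9 + K) (Gᴺ (suc K)) B)) r) of λ ()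
  where
  nonadj = path-nonadj K ≤-refl B≤ B≢p (λ B≡n → B≢1 (trans B≡n (next-last K)))

Tᴺ-red : ∀ K {A B} → A ≢ 9 + K → Tᴺ K A B ≡ red → B ≡ 9 + K
Tᴺ-red K A≢ r with reddenAt-red (Gᴺ (suc K)) (λ _ _ → col≢red _) r
... | inj₁ A≡ = ⊥-elim (A≢ A≡)
... | inj₂ B≡ = B≡

T-maxRedDeg≤ : ∀ K → MaxRedDeg≤ (lift {10 + K} (Tᴺ K)) 2
T-maxRedDeg≤ K a with toℕ a ≟ 9 + K
... | yes a≡ = redDeg≤2 (lift (Tᴺ K)) a (prev K) 1 λ b r →
  Tᴺ-last-red K (s≤s⁻¹ (toℕ<n b)) (subst (λ x → Tᴺ K x (toℕ b) ≡ red) a≡ r)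
... | no a≢ = redDeg≤2 (lift (Tᴺ K)) a (9 + K) (9 + K) λ b r → inj₁ (Tᴺ-red K a≢ r)

G₁-contrSeq : ContrSeq 2 (G 1)
G₁-contrSeq = from-just (contrSeq? 2 (G 1)
  ((# 4 , # 5) ∷ (# 5 , # 6) ∷ (# 2 , # 3) ∷ (# 0 , # 1) ∷ (# 0 , # 5) ∷
   (# 0 , # 2) ∷ (# 0 , # 1) ∷ (# 0 , # 1) ∷ (# 0 , # 1) ∷ []))

T₀-contrSeq : ContrSeq 2 (lift {10} (Tᴺ 0))
T₀-contrSeq = from-just (contrSeq? 2 (lift (Tᴺ 0))
  ((# 4 , # 5) ∷ (# 5 , # 6) ∷ (# 2 , # 3) ∷ (# 0 , # 3) ∷ (# 0 , # 4) ∷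
   (# 0 , # 2) ∷ (# 0 , # 1) ∷ (# 0 , # 1) ∷ (# 0 , # 1) ∷ []))

T-contrSeq : ∀ K → ContrSeq 2 (lift {10 + K} (Tᴺ K))
T-contrSeq zero    = T₀-contrSeq
T-contrSeq (suc K) = contrSeq-last-two (T-contract-last-two K) (T-maxRedDeg≤ K) (T-contrSeq K)

G-contrSeq : ∀ K → ContrSeq 2 (G (suc K))
G-contrSeq zero    = G₁-contrSeq
G-contrSeq (suc K) = contrSeq-last-two (G-contract-last-two K) (T-maxRedDeg≤ K) (T-contrSeq K)

proposition6p8 : (k : ℕ) → 1 ≤ k → TwinWidth≡ (G k) 2
proposition6p8 (suc K) _ =
  (G-maxRedDeg≤ (suc K) , G-contrSeq K) , separated⇒¬twwAtMost (G (suc K)) (G-separated K)
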